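{- In the greedy top tree construction, a single iteration (Step 1 followed by Step 2) shrinks the auxiliary tree $\tilde T$ by a factor of at least $8/7$: if $\tilde T$ has $n$ nodes at the start of the iteration, it has at most $7n/8$ nodes at its end.
   Context: A labeled tree $T$ is a rooted, ordered tree; $p(v)$ denotes the parent of $v$. Clusters of $T$ are certain connected tree patterns with a top boundary node and possibly a bottom boundary node; a single edge $(v,p(v))$ is a cluster with top boundary $p(v)$ and bottom boundary $v$ unless $v$ is a leaf of $T$. Greedy construction. Maintain an auxiliary rooted ordered tree $\tilde T$, initially $T$, whose edges correspond to clusters (initially the edges of $T$). Merging two edges $(u,v),(v,w)$ of $\tilde T$ merges the corresponding clusters; if $v$ is the parent of $u$ and the only child of $w$ (vertical merge) the two edges are replaced by $(u,w)$; if $v$ is the parent of both $u,w$ and one of $u,w$ is a leaf (horizontal merge) they are replaced by a single edge from $v$ to one of $u,w$ (the non-leaf one, if any). While $\tilde T$ has more than one edge, do an iteration: Step 1 (horizontal): for each node $v$ of $\tilde T$ with children $v_1,\dots,v_k$ (left to right), $k\ge 2$, for $i=1,\dots,\lfloor k/2\rfloor$ merge $(v,v_{2i-1}),(v,v_{2i})$ if $v_{2i-1}$ or $v_{2i}$ is a leaf; if $k$ is odd, $v_k$ is a leaf and $v_{k-2},v_{k-1}$ are non-leaves, also merge $(v,v_{k-1}),(v,v_k)$. Step 2 (vertical): for each maximal path $v_1,\dots,v_p$ with $v_{i+1}$ the parent of $v_i$ and $v_2,\dots,v_{p-1}$ each having exactly one child, with $e_i=(v_i,v_{i+1})$: if $p$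 is even merge $\{e_1,e_2\},\{e_3,e_4\},\dots,\{e_{p-3},e_{p-2}\}$; if $p$ is odd merge $\{e_1,e_2\},\dots,\{e_{p-4},e_{p-3}\}$ and also $\{e_{p-2},e_{p-1}\}$ if $e_{p-1}$ was not merged in Step 1. -}

module Defs where

open import Data.Nat using (ℕ; zero; suc; _+_; _∸_)
open import Data.Bool using (Bool; true; false; if_then_else_; _∧_; _∨_; not)
open import Data.List using (List; []; _∷_; _++_)
open import Data.Product using (_×_; _,_)

-- Rooted ordered (unlabelled) trees: the auxiliary tree T̃.
-- Node labels / cluster contents do not affect the shape of T̃, so they are omitted.
data Tree : Set where
  node : List Tree → Tree

mutual
  size : Tree → ℕ
  size (node ts) = suc (sizes ts)

  sizes : List Tree → ℕ
  sizes [] = 0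
  sizes (t ∷ ts) = size t + sizes ts

isLeaf : Tree → Bool
isLeaf (node []) = true
isLeaf (node (_ ∷ _)) = false

-- Trees whose edges (to children) carry a mark: true = this edge of T̃ was
-- produced by a horizontal merge in Step 1 of the current iteration.
data MTree : Set where
  mnode : List (Bool × MTree) → MTree

mergeP : Bool → Bool → MTree → MTree → List (Bool × MTree)
mergeP la lb ma mb =
  if la ∨ lb
  then (true , (if la then mb else ma)) ∷ []
  else (false , ma) ∷ (false , mb) ∷ []

-- Children are paired (v1,v2),(v3,v4),...; when exactly three children remain
-- they are v_{k-2},v_{k-1},v_k with k odd, and the extra rule applies.
mutual
  step1 : Tree → MTree
  step1 (node ts) = mnode (pairUp ts)

  pairUp : List Tree → List (Bool × MTree)
  pairUp [] = []
  pairUp (a ∷ []) = (false , step1 a) ∷ []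
  pairUp (a ∷ b ∷ c ∷ []) =
    if isLeaf c ∧ not (isLeaf a) ∧ not (isLeaf b)
    then (false , step1 a) ∷ (true , step1 b) ∷ []
    else mergeP (isLeaf a) (isLeaf b) (step1 a) (step1 b) ++ ((false , step1 c) ∷ [])
  pairUp (a ∷ b ∷ rest) = mergeP (isLeaf a) (isLeaf b) (step1 a) (step1 b) ++ pairUp rest

-- Number of vertical merges performed on a maximal path with q = p - 1 edges
-- e_1,...,e_q (bottom to top), where m says whether the top edge e_q = e_{p-1}
-- was merged in Step 1:  q odd (p even): pairs {e1,e2},...,{e_{q-2},e_{q-1}};
-- q even (p odd): pairs {e1,e2},...,{e_{q-3},e_{q-2}} and {e_{q-1},e_q} iff not m.
removed : Bool → ℕ → ℕ
removed m 0 = 0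
removed m 1 = 0
removed m 2 = if m then 0 else 1
removed m (suc (suc q)) = suc (removed m q)

wrap : ℕ → Tree → Tree
wrap zero t = t
wrap (suc k) t = node (wrap k t ∷ [])

-- Every edge lies on exactly one maximal path
-- v_1,...,v_p; its top v_p is the root or a node with ≥ 2 children, its bottom v_1
-- has ≠ 1 children, and v_2..v_{p-1} are unary. Each vertical merge of e_i,e_{i+1}
-- removes the unary node v_{i+1}; since these are unary, the resulting path is a
-- unary chain of the remaining interior nodes.
mutual
  step2 : MTree → Tree
  step2 (mnode cs) = node (edges cs)

  edges : List (Bool × MTree) → List Tree
  edges [] = []
  edges ((m , t) ∷ cs) = chain m 0 t ∷ edges cs

  -- m: mark of the top edge of the path, k: interior (unary) nodes passed so far,
  -- current node t
  chain : Bool → ℕ → MTree → Tree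
  chain m k (mnode (( _ , t') ∷ [])) = chain m (suc k) t'
  chain m k (mnode cs) = wrap (k ∸ removed m (suc k)) (node (edges cs))

iteration : Tree → Tree
iteration t = step2 (step1 t)

-- Step 2 halves the unary part of every maximal path of T̃: a path whose top edge has mark m and which has k
-- unary nodes keeps survivors m k ≈ k / 2 of them.  By induction on the tree, a subtree with s nodes below an
-- edge becomes x nodes with 8 x ≤ 7 s + 2 if that edge was created by a horizontal merge, 8 x ≤ 7 s + 1
-- otherwise, and 8 x + 1 ≤ 7 s if moreover the subtree is not a leaf.  A list of at least two siblings satisfies
-- 8 x + 2 ≤ 7 s, since Step 1 either absorbs a leaf (gaining 7) or pairs two non-leaves (gaining 1 each).
-- Adding the root to the bound for its children gives 8 n′ ≤ 7 n.
module Submission where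

open import Defs
open import Data.Nat using (ℕ; _*_; _≤_; _<_)
open import Data.Nat using (zero; suc; _+_; _∸_; z≤n; s≤s; _≤ᵇ_)
open import Data.Nat.Properties
open import Data.Nat.Tactic.RingSolver using (solve)
open import Data.Bool using (Bool; true; false; _∧_; not; T)
open import Data.List using (List; []; _∷_; _++_; length)
open import Data.Product using (_,_)
open import Relation.Binary.PropositionalEquality
open import Function using (_$_)

private variable
  m : Bool
  x y s t A B C D k : ℕ

-- A part of T̃ with s nodes becomes x nodes in the iteration; A and B are slack.
record Shrinks (x s A B : ℕ) : Set where
  constructor shrinks
  field bound : 8 * x + A ≤ 7 * s + B

infixr 5 _⊕_

_⊕_ : Shrinks x s A B → Shrinks y t C D → Shrinks (x + y) (s + t) (A + C) (B + D)
_⊕_ {x} {s} {A} {B} {y} {t} {C} {D} (shrinks p) (shrinks q) = shrinks $ begin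
  8 * (x + y) + (A + C)     ≡⟨ solve (x ∷ y ∷ A ∷ C ∷ []) ⟩
  (8 * x + A) + (8 * y + C) ≤⟨ +-mono-≤ p q ⟩
  (7 * s + B) + (7 * t + D) ≡⟨ solve (s ∷ t ∷ B ∷ D ∷ []) ⟩
  7 * (s + t) + (B + D)     ∎
  where open ≤-Reasoning

nil : Shrinks 0 0 0 0
nil = shrinks z≤n

by-computation : {p : T (x ≤ᵇ y)} → x ≤ y
by-computation {x} {y} {p} = ≤ᵇ⇒≤ x y p

relax : {A′ B′ : ℕ} {p : T (A′ + B ≤ᵇ A + B′)} → Shrinks x s A B → Shrinks x s A′ B′
relax {B} {A} {x} {s} {A′} {B′} {p} (shrinks q) = shrinks $ +-cancelʳ-≤ B _ _ $ begin
  8 * x + A′ + B   ≡⟨ +-assoc (8 * x) A′ B ⟩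
  8 * x + (A′ + B) ≤⟨ +-monoʳ-≤ (8 * x) (≤ᵇ⇒≤ _ _ p) ⟩
  8 * x + (A + B′) ≡⟨ solve (x ∷ A ∷ B′ ∷ []) ⟩
  8 * x + A + B′   ≤⟨ +-monoˡ-≤ B′ q ⟩
  7 * s + B + B′   ≡⟨ solve (s ∷ B ∷ B′ ∷ []) ⟩
  7 * s + B′ + B   ∎
  where open ≤-Reasoning

shrinks-cancel : ∀ c → Shrinks x s (c + A) (c + B) → Shrinks x s A B
shrinks-cancel {x} {s} {A} {B} c (shrinks p) = shrinks $ +-cancelˡ-≤ c _ _ $ begin
  c + (8 * x + A) ≡⟨ solve (c ∷ x ∷ A ∷ []) ⟩
  8 * x + (c + A) ≤⟨ p ⟩
  7 * s + (c + B) ≡⟨ solve (c ∷ s ∷ B ∷ []) ⟩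
  c + (7 * s + B) ∎
  where open ≤-Reasoning

shrinks-suc : Shrinks x s A B → Shrinks x (suc s) A B
shrinks-suc {s = s} {B = B} (shrinks p) =
  shrinks $ ≤-trans p (+-monoˡ-≤ B (*-monoʳ-≤ 7 (n≤1+n s)))

resize : x ≡ y → s ≡ t → Shrinks x s A B → Shrinks y t A B
resize refl refl p = p

shrinks⇒≤ : Shrinks x s 0 0 → 8 * x ≤ 7 * s
shrinks⇒≤ (shrinks p) = subst₂ _≤_ (+-identityʳ _) (+-identityʳ _) p

root-bound : Shrinks x s 1 0 → Shrinks (suc x) (suc s) 0 0
root-bound p = shrinks-cancel 1 (root ⊕ p)
  where
  root : Shrinks 1 1 0 1
  root = shrinks by-computation

absorbed-leaf : Shrinks 0 1 7 0
absorbed-leaf = shrinks by-computation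

wrap-size : ∀ n t → size (wrap n t) ≡ n + size t
wrap-size zero    t = refl
wrap-size (suc n) t = cong suc (trans (+-identityʳ _) (wrap-size n t))

survivors : Bool → ℕ → ℕ
survivors m k = k ∸ removed m (suc k)

removed-≤ : ∀ m k → removed m (suc k) ≤ k
removed-≤ m     zero          = z≤n
removed-≤ true  (suc zero)    = z≤n
removed-≤ false (suc zero)    = s≤s z≤n
removed-≤ m     (suc (suc k)) = s≤s (≤-trans (removed-≤ m k) (n≤1+n k))

survivors-step : ∀ m k → survivors m (2 + k) ≡ suc (survivors m k)
survivors-step m k = +-∸-assoc 1 (removed-≤ m k)

chainSize : Bool → ℕ → Tree → ℕ
chainSize m k t = size (chain m k (step1 t))

pairedSize : List Tree → ℕ
pairedSize ts = sizes (edges (pairUp ts))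

chain-size-branching : ∀ m k cs → 2 ≤ length cs →
                       size (chain m k (mnode cs)) ≡ survivors m k + suc (sizes (edges cs))
chain-size-branching m k (_ ∷ [])     (s≤s ())
chain-size-branching m k cs@(_ ∷ _ ∷ _) _ = wrap-size (survivors m k) (node (edges cs))

mergeP-++-nonempty : ∀ a b {ys} → x ≤ length ys →
                     suc x ≤ length (mergeP (isLeaf a) (isLeaf b) (step1 a) (step1 b) ++ ys)
mergeP-++-nonempty (node [])      b              p = s≤s p
mergeP-++-nonempty (node (_ ∷ _)) (node [])      p = s≤s p
mergeP-++-nonempty (node (_ ∷ _)) (node (_ ∷ _)) p = s≤s (≤-trans p (n≤1+n _))

mutual
  pairUp-nonempty : ∀ a rest → 1 ≤ length (pairUp (a ∷ rest))
  pairUp-nonempty a []            = s≤s z≤n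
  pairUp-nonempty a (b ∷ [])      = mergeP-++-nonempty a b z≤n
  pairUp-nonempty a (b ∷ c ∷ cs)  = ≤-trans (s≤s z≤n) (pairUp-branching a b c cs)

  pairUp-branching : ∀ a b c rest → 2 ≤ length (pairUp (a ∷ b ∷ c ∷ rest))
  pairUp-branching a b c [] with isLeaf c ∧ not (isLeaf a) ∧ not (isLeaf b)
  ... | true  = s≤s (s≤s z≤n)
  ... | false = mergeP-++-nonempty a b (s≤s z≤n)
  pairUp-branching a b c (d ∷ rest) = mergeP-++-nonempty a b (pairUp-nonempty c (d ∷ rest))

-- The k unary nodes and the bottom node v of a maximal path with top mark m become survivors m k + 1 nodes;
-- the budgets are the bounds this part must meet when v is a leaf, resp. keeps two or more children in Step 1.
LeafBudget : Bool → ℕ → ℕ → ℕ → Set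
LeafBudget m A B k = Shrinks (survivors m k + 1) (k + 1) A B

BranchBudget : Bool → ℕ → ℕ → ℕ → Set
BranchBudget m A B k = Shrinks (survivors m k + 1) (k + 1) A (2 + B)

leafBudget⇒branchBudget : LeafBudget m A B k → BranchBudget m A B k
leafBudget⇒branchBudget {k = k} (shrinks p) =
  shrinks $ ≤-trans p (+-monoʳ-≤ (7 * (k + 1)) (m≤n+m _ 2))

leafBudget-step : ∀ m k → LeafBudget m A B k → LeafBudget m A B (2 + k)
leafBudget-step m k p =
  resize (cong (_+ 1) (sym (survivors-step m k))) refl (two-unary-nodes ⊕ p)
  where
  two-unary-nodes : Shrinks 1 2 0 0
  two-unary-nodes = shrinks by-computation

marked-budget : ∀ k → LeafBudget true 0 2 k
marked-budget 0             = shrinks by-computation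
marked-budget 1             = shrinks by-computation
marked-budget (suc (suc k)) = leafBudget-step true _ (marked-budget k)

unmarked-budget : ∀ k → LeafBudget false 0 1 k
unmarked-budget 0             = shrinks by-computation
unmarked-budget 1             = shrinks by-computation
unmarked-budget (suc (suc k)) = leafBudget-step false _ (unmarked-budget k)

internal-budget : ∀ k → LeafBudget false 1 0 (suc k)
internal-budget 0             = shrinks by-computation
internal-budget 1             = shrinks by-computation
internal-budget (suc (suc k)) = leafBudget-step false (suc k) (internal-budget k)

branching-bound : ∀ k ts → 2 ≤ length (pairUp ts) → BranchBudget m A B k →
                  Shrinks (pairedSize ts) (sizes ts) 2 0 →
                  Shrinks (chainSize m k (node ts)) (k + size (node ts)) A B
branching-bound {m} k ts two budget children =
  resize (trans (+-comm-suc (pairedSize ts) (survivors m k))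
                (sym (chain-size-branching m k (pairUp ts) two)))
         (+-comm-suc (sizes ts) k)
         (shrinks-cancel 2 (children ⊕ budget))
  where
  +-comm-suc : ∀ x y → x + (y + 1) ≡ y + suc x
  +-comm-suc x y = solve (x ∷ y ∷ [])

mutual
  chain-bound : ∀ k → (∀ j → k < j → LeafBudget m A B j) → BranchBudget m A B k →
                ∀ t → (isLeaf t ≡ true → LeafBudget m A B k) →
                Shrinks (chainSize m k t) (k + size t) A B
  chain-bound {m} k _ _ (node []) leaf =
    resize (sym (wrap-size (survivors m k) (node []))) refl (leaf refl)
  chain-bound k above _ (node (a ∷ [])) _ =
    resize refl (sizes-eq k (size a)) (chain-bound-suc k above a)
    where
    sizes-eq : ∀ k n → suc k + n ≡ k + suc (n + 0)
    sizes-eq k n = solve (k ∷ n ∷ [])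
  chain-bound k above _ (node (node [] ∷ b ∷ [])) _ =
    resize refl (sizes-eq k (size b)) (shrinks-suc (chain-bound-suc k above b))
    where
    sizes-eq : ∀ k n → suc (suc k + n) ≡ k + suc (1 + (n + 0))
    sizes-eq k n = solve (k ∷ n ∷ [])
  chain-bound k above _ (node (a@(node (_ ∷ _)) ∷ node [] ∷ [])) _ =
    resize refl (sizes-eq k (size a)) (shrinks-suc (chain-bound-suc k above a))
    where
    sizes-eq : ∀ k n → suc (suc k + n) ≡ k + suc (n + (1 + 0))
    sizes-eq k n = solve (k ∷ n ∷ [])
  chain-bound k _ budget (node (a@(node (_ ∷ _)) ∷ b@(node (_ ∷ _)) ∷ [])) _ =
    branching-bound k (a ∷ b ∷ []) (s≤s (s≤s z≤n)) budget (paired-bound a b [])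
  chain-bound k _ budget (node (a ∷ b ∷ c ∷ rest)) _ =
    branching-bound k (a ∷ b ∷ c ∷ rest) (pairUp-branching a b c rest) budget
      (paired-bound a b (c ∷ rest))

  chain-bound-suc : ∀ k → (∀ j → k < j → LeafBudget m A B j) → ∀ t →
                    Shrinks (chainSize m (suc k) t) (suc k + size t) A B
  chain-bound-suc k above t =
    chain-bound (suc k) (λ j k<j → above j (<-trans (n<1+n k) k<j))
                (leafBudget⇒branchBudget {k = suc k} next) t (λ _ → next)
    where next = above (suc k) (n<1+n k)

  marked-bound : ∀ t → Shrinks (chainSize true 0 t) (size t) 0 2
  marked-bound t =
    chain-bound 0 (λ j _ → marked-budget j) (shrinks by-computation) t (λ _ → marked-budget 0)

  unmarked-bound : ∀ t → Shrinks (chainSize false 0 t) (size t) 0 1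
  unmarked-bound t =
    chain-bound 0 (λ j _ → unmarked-budget j) (shrinks by-computation) t (λ _ → unmarked-budget 0)

  internal-bound : ∀ t → isLeaf t ≡ false → Shrinks (chainSize false 0 t) (size t) 1 0
  internal-bound t@(node (_ ∷ _)) refl =
    chain-bound 0 (λ { (suc j) _ → internal-budget j }) (shrinks by-computation) t (λ ())

  paired-bound : ∀ a b rest → Shrinks (pairedSize (a ∷ b ∷ rest)) (sizes (a ∷ b ∷ rest)) 2 0
  paired-bound (node []) b [] = relax (absorbed-leaf ⊕ marked-bound b ⊕ nil)
  paired-bound a@(node (_ ∷ _)) (node []) [] = relax (marked-bound a ⊕ absorbed-leaf ⊕ nil)
  paired-bound a@(node (_ ∷ _)) b@(node (_ ∷ _)) [] =
    internal-bound a refl ⊕ internal-bound b refl ⊕ nil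
  paired-bound (node []) b (c@(node []) ∷ []) =
    relax (absorbed-leaf ⊕ marked-bound b ⊕ unmarked-bound c ⊕ nil)
  paired-bound (node []) b (c@(node (_ ∷ _)) ∷ []) =
    relax (absorbed-leaf ⊕ marked-bound b ⊕ unmarked-bound c ⊕ nil)
  paired-bound a@(node (_ ∷ _)) (node []) (c@(node []) ∷ []) =
    relax (marked-bound a ⊕ absorbed-leaf ⊕ unmarked-bound c ⊕ nil)
  paired-bound a@(node (_ ∷ _)) (node []) (c@(node (_ ∷ _)) ∷ []) =
    relax (marked-bound a ⊕ absorbed-leaf ⊕ unmarked-bound c ⊕ nil)
  paired-bound a@(node (_ ∷ _)) b@(node (_ ∷ _)) (node [] ∷ []) =
    relax (internal-bound a refl ⊕ marked-bound b ⊕ absorbed-leaf ⊕ nil)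
  paired-bound a@(node (_ ∷ _)) b@(node (_ ∷ _)) (c@(node (_ ∷ _)) ∷ []) =
    relax (internal-bound a refl ⊕ internal-bound b refl ⊕ internal-bound c refl ⊕ nil)
  paired-bound (node []) b (c ∷ d ∷ rest) =
    relax (absorbed-leaf ⊕ marked-bound b ⊕ paired-bound c d rest)
  paired-bound a@(node (_ ∷ _)) (node []) (c ∷ d ∷ rest) =
    relax (marked-bound a ⊕ absorbed-leaf ⊕ paired-bound c d rest)
  paired-bound a@(node (_ ∷ _)) b@(node (_ ∷ _)) (c ∷ d ∷ rest) =
    relax (internal-bound a refl ⊕ internal-bound b refl ⊕ paired-bound c d rest)

lemma1 : (t : Tree) → 2 < size t → 8 * size (iteration t) ≤ 7 * size t
lemma1 (node [])                        (s≤s ())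
lemma1 (node (node [] ∷ []))            (s≤s (s≤s ()))
lemma1 (node (a@(node (_ ∷ _)) ∷ []))   _ = shrinks⇒≤ (root-bound (internal-bound a refl ⊕ nil))
lemma1 (node (a ∷ b ∷ rest))            _ = shrinks⇒≤ (root-bound (relax (paired-bound a b rest)))
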